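{- Work in Incomprehensive Set Theory (defined in the context). If $x$ is an upper, then $x^{ -- }\neq x$.
   Context: Incomprehensive Set Theory is the first-order theory in the language $\{\in,=\}$ whose only axioms are: Existence of Successor, $\forall x\,\exists! y\,\forall z\,(z\in y \iff z\in x \lor z=x)$; and Existence of Predecessor, $\forall x\,\exists! y\,\forall z\,(z\in y\iff z\in x\wedge z\neq x)$. The unique $y$ in the second axiom is written $x^{ -- }$. An object $x$ is an upper if $\forall z\,(z\notin z\Rightarrow z\in x)$. -}

module Defs where

open import Level using (Level; suc; _⊔_)
open import Data.Product using (Σ; _×_; ∃; proj₁)
open import Data.Sum using (_⊎_)
open import Relation.Nullary using (¬_)
open import Relation.Binary.PropositionalEquality using (_≡_)
open import Function.Bundles using (_⇔_)

∃! : ∀ {a p} {A : Set a} → (A → Set p) → Set (a ⊔ p)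
∃! {A = A} P = Σ A (λ y → P y × (∀ y' → P y' → y' ≡ y))

IsSucc : ∀ {a ℓ} {M : Set a} → (M → M → Set ℓ) → M → M → Set (a ⊔ ℓ)
IsSucc _∈_ x y = ∀ z → (z ∈ y) ⇔ ((z ∈ x) ⊎ (z ≡ x))

IsPred : ∀ {a ℓ} {M : Set a} → (M → M → Set ℓ) → M → M → Set (a ⊔ ℓ)
IsPred _∈_ x y = ∀ z → (z ∈ y) ⇔ ((z ∈ x) × ¬ (z ≡ x))

-- A model of Incomprehensive Set Theory: a domain with a membership relation
-- (equality interpreted as identity) satisfying the two axioms.
record IST (a ℓ : Level) : Set (suc (a ⊔ ℓ)) where
  field
    M : Set a
    _∈_ : M → M → Set ℓ
    succ-ax : ∀ x → ∃! (IsSucc _∈_ x)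
    pred-ax : ∀ x → ∃! (IsPred _∈_ x)

  _⁻⁻ : M → M
  x ⁻⁻ = proj₁ (pred-ax x)

  Upper : M → Set (a ⊔ ℓ)
  Upper x = ∀ z → ¬ (z ∈ z) → z ∈ x

-- If x⁻⁻ = x then x ∉ x, since x is never a member of x⁻⁻; but then x, being an
-- upper, contains the non-self-membered object x, i.e. x ∈ x.
module Submission where

open import Defs
open import Relation.Nullary using (¬_)
open import Relation.Binary.PropositionalEquality using (_≡_; refl; sym; subst)
open import Data.Product using (proj₁; proj₂)
open import Function.Bundles using (Equivalence)

module _ {a ℓ} (T : IST a ℓ) where
  open IST T

  ∉-pred : ∀ x → ¬ (x ∈ (x ⁻⁻))
  ∉-pred x x∈x⁻⁻ = proj₂ (Equivalence.to (proj₁ (proj₂ (pred-ax x)) x) x∈x⁻⁻) refl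

  pred-fixed⇒∉-self : ∀ {x} → x ⁻⁻ ≡ x → ¬ (x ∈ x)
  pred-fixed⇒∉-self {x} eq x∈x = ∉-pred x (subst (x ∈_) (sym eq) x∈x)

lemma4p3 : ∀ {a ℓ} (T : IST a ℓ) → let open IST T in
    ∀ x → Upper x → ¬ (x ⁻⁻ ≡ x)
lemma4p3 T x upper eq = x∉x (upper x x∉x)
  where
  open IST T
  x∉x : ¬ (x ∈ x)
  x∉x = pred-fixed⇒∉-self T eq
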